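{- For every type $\mathbf m\neq[\,]$, $$C_{\mathbf m}=\sum_{\mathbf k\in L(\mathbf m)}G_{\mathbf k},$$ where $L(\mathbf m)=\{\mathbf k:\ \mathbf m=\mathbf k+\vec j\text{ for some natural }j\ge2\}$ (i.e. the types obtained from $\mathbf m$ by subtracting $1$ from one of its nonzero components).
   Context: A type is a vector $\mathbf m=[m_2,m_3,\ldots]$ of natural numbers (indices start at $2$) with finitely many nonzero entries; $[\,]$ is the zero type, $\vec j$ is the type with $1$ in position $j$ and $0$ elsewhere, and $\mathbf t^{\mathbf m}=t_2^{m_2}t_3^{m_3}\cdots$. The hyper-Catalan number is $C_{\mathbf m}=\frac{(2m_2+3m_3+4m_4+\cdots)!}{(1+m_2+2m_3+3m_4+\cdots)!\,m_2!\,m_3!\cdots}$ and $\mathbf S=\sum_{\mathbf m}C_{\mathbf m}\mathbf t^{\mathbf m}$. It is known that there is a unique formal power series $\mathbf G$ (the Geode) in $t_2,t_3,\ldots$ with $\mathbf S-1=(t_2+t_3+t_4+\cdots)\mathbf G$; $G_{\mathbf n}$ denotes the coefficient of $\mathbf t^{\mathbf n}$ in $\mathbf G$. -}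

module Defs where

open import Data.Nat as ℕ using (ℕ; zero; suc; _!; _∸_; NonZero)
open import Data.Nat.Properties using (m*n≢0; _!≢0)
open import Data.Nat.DivMod using (_/_)
open import Data.Integer as ℤ using (ℤ; +_)
open import Data.List using (List; []; _∷_; [_]; _++_; map; foldr; concatMap; upTo; zipWith)
open import Data.Nat.ListAction using (sum)
open import Relation.Binary.PropositionalEquality using (_≡_)

-- A type m = [m₂, m₃, …] is represented by a list of naturals:
-- position i (0-based) of the list holds m_{i+2}; missing trailing
-- entries are 0.  Lists differing only by trailing zeros represent
-- the same type; `trim` gives the canonical representative.
Ty : Set
Ty = List ℕ

cons′ : ℕ → List ℕ → List ℕ
cons′ zero [] = []
cons′ x ys = x ∷ ys

trim : Ty → Ty
trim = foldr cons′ []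

weighted : ℕ → Ty → ℕ
weighted w [] = 0
weighted w (x ∷ xs) = w ℕ.* x ℕ.+ weighted (suc w) xs

numArg : Ty → ℕ
numArg = weighted 2

denArg : Ty → ℕ
denArg m = suc (weighted 1 m)

prodFact : Ty → ℕ
prodFact [] = 1
prodFact (x ∷ xs) = x ! ℕ.* prodFact xs

prodFact≢0 : ∀ m → NonZero (prodFact m)
prodFact≢0 [] = _
prodFact≢0 (x ∷ xs) = m*n≢0 (x !) (prodFact xs) {{x !≢0}} {{prodFact≢0 xs}}

denom : Ty → ℕ
denom m = denArg m ! ℕ.* prodFact m

denom≢0 : ∀ m → NonZero (denom m)
denom≢0 m = m*n≢0 (denArg m !) (prodFact m) {{denArg m !≢0}} {{prodFact≢0 m}}

C : Ty → ℕ
C m = (numArg m ! / denom m) {{denom≢0 m}}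

-- formal power series in t₂, t₃, … with integer coefficients:
-- the coefficient of t^m in F is read off as coeff F m = F (trim m)
Series : Set
Series = Ty → ℤ

coeff : Series → Ty → ℤ
coeff F m = F (trim m)

sumℤ : List ℤ → ℤ
sumℤ = foldr ℤ._+_ (+ 0)

box : Ty → List Ty
box [] = [ [] ]
box (x ∷ xs) = concatMap (λ a → map (a ∷_) (box xs)) (upTo (suc x))

mulCoeff : Series → Series → Ty → ℤ
mulCoeff A B m = sumℤ (map (λ k → coeff A k ℤ.* coeff B (zipWith _∸_ m k)) (box m))

-- the series t₂ + t₃ + t₄ + … : coefficient 1 exactly at the unit types
tsum : Series
tsum k with sum k
... | 1 = + 1
... | _ = + 0

-- the series S − 1 = Σ_m C_m t^m − 1
δ₀ : Ty → ℤ
δ₀ m with trim m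
... | [] = + 1
... | _ ∷ _ = + 0

SMinus1 : Series
SMinus1 m = + C m ℤ.- δ₀ m

-- G is the Geode: S − 1 = (t₂ + t₃ + ⋯) G as formal power series
IsGeode : Series → Set
IsGeode G = ∀ (m : Ty) → mulCoeff tsum G m ≡ coeff SMinus1 m

lower : Ty → List Ty
lower [] = []
lower (zero ∷ xs) = map (zero ∷_) (lower xs)
lower (suc x ∷ xs) = (x ∷ xs) ∷ map (suc x ∷_) (lower xs)

module Submission where

open import Defs
open import Data.Nat using (ℕ)
open import Data.Integer using (+_)
open import Data.List using (List; map)
open import Data.List.Relation.Unary.All using (All)
open import Relation.Nullary using (¬_)
open import Relation.Binary.PropositionalEquality using (_≡_)

open import Data.Nat as ℕ using (zero; suc; _∸_; _!)
import Data.Nat.Properties as ℕₚ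
open import Data.Nat.DivMod using (_/_; /-congˡ; /-congʳ)
open import Data.Nat.ListAction using (sum)
open import Data.Integer using (ℤ; _+_; _*_; _-_)
open import Data.Integer.Properties using (+-identityˡ; +-identityʳ; +-assoc; +-comm; *-zeroˡ; *-identityˡ)
open import Data.List using ([]; _∷_; [_]; _++_; concatMap; upTo; applyUpTo; zipWith)
open import Data.List.Properties using (map-++; map-cong; map-∘)
open import Data.List.Relation.Unary.All using ([]; _∷_)
open import Data.Product using (_×_; _,_)
open import Data.Empty using (⊥-elim)
open import Function using (_∘_; id)
open import Relation.Binary.PropositionalEquality using (refl; sym; trans; cong; cong₂; module ≡-Reasoning)

-- The Cauchy product Σ_{k ≤ m} [|k| = 1] G_{m−k} only sees the k = e_j with j in
-- the support of m, so ((t₂ + t₃ + ⋯) G)_m = Σ_{k ∈ L(m)} G_k for every series G.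
-- For the Geode the left side is the coefficient of S − 1, i.e. C_m when m ≠ [].
-- The sum over the box is computed column by column, which needs the indicator
-- [s + |k| = 1] for an arbitrary offset s accumulated from the columns already fixed.

sumℤ-++ : ∀ xs ys → sumℤ (xs ++ ys) ≡ sumℤ xs + sumℤ ys
sumℤ-++ [] ys = sym (+-identityˡ _)
sumℤ-++ (x ∷ xs) ys = trans (cong (_+_ x) (sumℤ-++ xs ys)) (sym (+-assoc x _ _))

sumℤ-concatMap : ∀ {A B : Set} (F : B → ℤ) (h : A → List B) xs →
  sumℤ (map F (concatMap h xs)) ≡ sumℤ (map (λ a → sumℤ (map F (h a))) xs)
sumℤ-concatMap F h [] = refl
sumℤ-concatMap F h (a ∷ xs) = begin
  sumℤ (map F (h a ++ concatMap h xs))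
    ≡⟨ cong sumℤ (map-++ F (h a) (concatMap h xs)) ⟩
  sumℤ (map F (h a) ++ map F (concatMap h xs))
    ≡⟨ sumℤ-++ (map F (h a)) _ ⟩
  sumℤ (map F (h a)) + sumℤ (map F (concatMap h xs))
    ≡⟨ cong (_+_ (sumℤ (map F (h a)))) (sumℤ-concatMap F h xs) ⟩
  sumℤ (map F (h a)) + sumℤ (map (λ a → sumℤ (map F (h a))) xs) ∎
  where open ≡-Reasoning

sumℤ-applyUpTo-zero : ∀ (F : ℕ → ℤ) (g : ℕ → ℕ) n →
  (∀ b → F (g b) ≡ + 0) → sumℤ (map F (applyUpTo g n)) ≡ + 0
sumℤ-applyUpTo-zero F g zero _ = refl
sumℤ-applyUpTo-zero F g (suc n) F∘g≡0 =
  cong₂ _+_ (F∘g≡0 0) (sumℤ-applyUpTo-zero F (g ∘ suc) n (F∘g≡0 ∘ suc))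

sumℤ-cong : ∀ {A : Set} {F F′ : A → ℤ} → (∀ a → F a ≡ F′ a) →
  ∀ xs → sumℤ (map F xs) ≡ sumℤ (map F′ xs)
sumℤ-cong F≗F′ xs = cong sumℤ (map-cong F≗F′ xs)

cons′-respects : ∀ {A : Set} (φ : Ty → A) → φ [ 0 ] ≡ φ [] →
  ∀ x ys → φ (cons′ x ys) ≡ φ (x ∷ ys)
cons′-respects φ φ[0]≡φ[] zero [] = sym φ[0]≡φ[]
cons′-respects φ _ zero (_ ∷ _) = refl
cons′-respects φ _ (suc _) _ = refl

cons′≡[] : ∀ x ys → cons′ x ys ≡ [] → x ≡ 0 × ys ≡ []
cons′≡[] zero [] _ = refl , refl

trim≡[]⇒zeros : ∀ m → trim m ≡ [] → All (_≡ 0) m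
trim≡[]⇒zeros [] _ = []
trim≡[]⇒zeros (x ∷ xs) eq with cons′≡[] x (trim xs) eq
... | x≡0 , trim-xs≡[] = x≡0 ∷ trim≡[]⇒zeros xs trim-xs≡[]

trim-idem : ∀ m → trim (trim m) ≡ trim m
trim-idem [] = refl
trim-idem (x ∷ xs) =
  trans (cons′-respects trim refl x (trim xs)) (cong (cons′ x) (trim-idem xs))

sum-trim : ∀ k → sum (trim k) ≡ sum k
sum-trim [] = refl
sum-trim (x ∷ xs) =
  trans (cons′-respects sum refl x (trim xs)) (cong (x ℕ.+_) (sum-trim xs))

weighted-trim : ∀ w k → weighted w (trim k) ≡ weighted w k
weighted-trim w [] = refl
weighted-trim w (x ∷ xs) =
  trans (cons′-respects (weighted w) (trans (ℕₚ.+-identityʳ _) (ℕₚ.*-zeroʳ w)) x (trim xs))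
        (cong (w ℕ.* x ℕ.+_) (weighted-trim (suc w) xs))

prodFact-trim : ∀ k → prodFact (trim k) ≡ prodFact k
prodFact-trim [] = refl
prodFact-trim (x ∷ xs) =
  trans (cons′-respects prodFact refl x (trim xs)) (cong (x ! ℕ.*_) (prodFact-trim xs))

C-trim : ∀ m → C (trim m) ≡ C m
C-trim m =
  trans (/-congˡ {{denom≢0 (trim m)}} (cong _! (weighted-trim 2 m)))
        (/-congʳ {{denom≢0 (trim m)}} {{denom≢0 m}}
                 (cong₂ ℕ._*_ (cong (λ w → suc w !) (weighted-trim 1 m)) (prodFact-trim m)))

δ₀-trim : ∀ m → δ₀ (trim m) ≡ δ₀ m
δ₀-trim m rewrite trim-idem m = refl

δ₀-nonzero : ∀ m → ¬ All (_≡ 0) m → δ₀ m ≡ + 0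
δ₀-nonzero m m≢0 with trim m in eq
... | [] = ⊥-elim (m≢0 (trim≡[]⇒zeros m eq))
... | _ ∷ _ = refl

coeff-SMinus1 : ∀ m → coeff SMinus1 m ≡ SMinus1 m
coeff-SMinus1 m = cong₂ (λ c d → + c - d) (C-trim m) (δ₀-trim m)

SMinus1-nonzero : ∀ m → ¬ All (_≡ 0) m → SMinus1 m ≡ + C m
SMinus1-nonzero m m≢0 =
  trans (cong (_-_ (+ C m)) (δ₀-nonzero m m≢0)) (+-identityʳ (+ C m))

isOne : ℕ → ℤ
isOne 1 = + 1
isOne _ = + 0

tsum≡isOne∘sum : ∀ k → tsum k ≡ isOne (sum k)
tsum≡isOne∘sum k with sum k
... | zero = refl
... | suc zero = refl
... | suc (suc _) = refl

boxSum : ℕ → Ty → (Ty → ℤ) → ℤ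
boxSum s m H = sumℤ (map (λ k → isOne (s ℕ.+ sum k) * H (zipWith _∸_ m k)) (box m))

lowerSum : ℕ → Ty → (Ty → ℤ) → ℤ
lowerSum 0 m H = sumℤ (map H (lower m))
lowerSum 1 m H = H m
lowerSum _ _ _ = + 0

-- Column a contributes only when s + a ≤ 1: always for a = 0, and for a = 1 when s = 0.
lowerSum-cons : ∀ s x xs (H : Ty → ℤ) →
  sumℤ (map (λ a → lowerSum (s ℕ.+ a) xs (H ∘ ((x ∸ a) ∷_))) (upTo (suc x)))
    ≡ lowerSum s (x ∷ xs) H
lowerSum-cons (suc (suc s)) x xs H =
  sumℤ-applyUpTo-zero _ id (suc x) (λ _ → refl)
lowerSum-cons 1 x xs H =
  trans (cong (_+_ (H (x ∷ xs))) (sumℤ-applyUpTo-zero _ suc x (λ _ → refl)))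
        (+-identityʳ _)
lowerSum-cons 0 zero xs H =
  trans (+-identityʳ _) (cong sumℤ (map-∘ (lower xs)))
lowerSum-cons 0 (suc x) xs H = begin
  below + (H (x ∷ xs) + sumℤ (map F (applyUpTo (suc ∘ suc) x)))
    ≡⟨ cong (λ z → below + (H (x ∷ xs) + z))
            (sumℤ-applyUpTo-zero F (suc ∘ suc) x (λ _ → refl)) ⟩
  below + (H (x ∷ xs) + + 0)
    ≡⟨ cong (_+_ below) (+-identityʳ _) ⟩
  below + H (x ∷ xs)
    ≡⟨ +-comm below _ ⟩
  H (x ∷ xs) + below
    ≡⟨ cong (λ z → H (x ∷ xs) + sumℤ z) (map-∘ (lower xs)) ⟩
  lowerSum 0 (suc x ∷ xs) H ∎
  where
  open ≡-Reasoning
  F : ℕ → ℤ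
  F a = lowerSum a xs (H ∘ ((suc x ∸ a) ∷_))
  below : ℤ
  below = sumℤ (map (H ∘ (suc x ∷_)) (lower xs))

boxSum≡lowerSum : ∀ s m H → boxSum s m H ≡ lowerSum s m H
boxSum≡lowerSum 0 [] H = trans (+-identityʳ _) (*-zeroˡ (H []))
boxSum≡lowerSum 1 [] H = trans (+-identityʳ _) (*-identityˡ (H []))
boxSum≡lowerSum (suc (suc s)) [] H = trans (+-identityʳ _) (*-zeroˡ (H []))
boxSum≡lowerSum s (x ∷ xs) H = begin
  boxSum s (x ∷ xs) H
    ≡⟨ sumℤ-concatMap term (λ a → map (a ∷_) (box xs)) (upTo (suc x)) ⟩
  sumℤ (map (λ a → sumℤ (map term (map (a ∷_) (box xs)))) (upTo (suc x)))
    ≡⟨ sumℤ-cong column (upTo (suc x)) ⟩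
  sumℤ (map (λ a → lowerSum (s ℕ.+ a) xs (H ∘ ((x ∸ a) ∷_))) (upTo (suc x)))
    ≡⟨ lowerSum-cons s x xs H ⟩
  lowerSum s (x ∷ xs) H ∎
  where
  open ≡-Reasoning
  term : Ty → ℤ
  term k = isOne (s ℕ.+ sum k) * H (zipWith _∸_ (x ∷ xs) k)
  column : ∀ a → sumℤ (map term (map (a ∷_) (box xs)))
                   ≡ lowerSum (s ℕ.+ a) xs (H ∘ ((x ∸ a) ∷_))
  column a = begin
    sumℤ (map term (map (a ∷_) (box xs)))
      ≡⟨ cong sumℤ (sym (map-∘ (box xs))) ⟩
    sumℤ (map (term ∘ (a ∷_)) (box xs))
      ≡⟨ sumℤ-cong (λ k → cong (λ z → isOne z * H ((x ∸ a) ∷ zipWith _∸_ xs k))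
                               (sym (ℕₚ.+-assoc s a (sum k))))
                   (box xs) ⟩
    boxSum (s ℕ.+ a) xs (H ∘ ((x ∸ a) ∷_))
      ≡⟨ boxSum≡lowerSum (s ℕ.+ a) xs (H ∘ ((x ∸ a) ∷_)) ⟩
    lowerSum (s ℕ.+ a) xs (H ∘ ((x ∸ a) ∷_)) ∎

mulCoeff-tsum : ∀ G m → mulCoeff tsum G m ≡ sumℤ (map (coeff G) (lower m))
mulCoeff-tsum G m =
  trans (sumℤ-cong (λ k → cong (_* coeff G (zipWith _∸_ m k)) (tsum-trim k)) (box m))
        (boxSum≡lowerSum 0 m (coeff G))
  where
  tsum-trim : ∀ k → tsum (trim k) ≡ isOne (sum k)
  tsum-trim k = trans (tsum≡isOne∘sum (trim k)) (cong isOne (sum-trim k))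

theorem6 : (G : Series) → IsGeode G →
    (m : Ty) → ¬ All (_≡ 0) m →
    + C m ≡ sumℤ (map (coeff G) (lower m))
theorem6 G isGeode m m≢0 = begin
  + C m                           ≡⟨ SMinus1-nonzero m m≢0 ⟨
  SMinus1 m                       ≡⟨ coeff-SMinus1 m ⟨
  coeff SMinus1 m                 ≡⟨ isGeode m ⟨
  mulCoeff tsum G m               ≡⟨ mulCoeff-tsum G m ⟩
  sumℤ (map (coeff G) (lower m))  ∎
  where open ≡-Reasoning
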